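{- Let $\mathbf v=\mathbf v_{a_rb_r}\cdots\mathbf v_{a_1b_1}$ be a composition of operators with support contained in $[n]$, let $u,w\in S_n$, $k\in[n-1]$ and $\alpha\in\mathbb Z_{\ge0}^{n-1}$. Then $\mathbf v\bullet_k u=\mathbf q^\alpha w$ if and only if $\rho(\mathbf v)\bullet_{n-k}\rho_n(w)=\mathbf q^{\mathfrak h(\alpha)}\rho_n(u)$.
   Context: For a positive integer $N$, $[N]=\{1,\dots,N\}$, $S_N$ is the symmetric group on $[N]$, $s_{ab}$ the transposition exchanging $a,b$, $\ell$ the number of inversions. With commuting indeterminates $q_1,\dots,q_{N-1}$, $\mathbf q^\alpha=\prod q_i^{\alpha_i}$, $\mathbf q_{ij}=q_i\cdots q_{j-1}$ ($i<j$), $S_N[\mathbf q]=\{\mathbf q^\alpha w\}$, $\ell(\mathbf q^\alpha w)=\ell(w)+2\deg\mathbf q^\alpha$. For $k\in[N-1]$ the quantum $k$-Bruhat order has covers, for $w\in S_N$ and $i\le k<j$: $w\lessdot_k ws_{ij}$ if $\ell(ws_{ij})=\ell(w)+1$, $w\lessdot_k\mathbf q_{ij}ws_{ij}$ if $\ell(\mathbf q_{ij}ws_{ij})=\ell(w)+1$; extended $\mathbf q$-multiplicatively. Operators $\mathbf v_{ab}$ ($a\neq b$ positive integers) generate a free monoid; a composition $\mathbf v_{a_rb_r}\cdots\mathbf v_{a_1b_1}$ has support $\{a_1,b_1,\dots,a_r,b_r\}$. For support in $[N]$, $k\in[N-1]$, $u\in S_N$: $\mathbf v_{ab}\bullet_ku=s_{ab}u$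 if $a<b$ and $u\lessdot_ks_{ab}u$; $=\mathbf q_{ij}s_{ab}u$ if $a>b$, $i=u^{ -1}(a)$, $j=u^{ -1}(b)$ and $u\lessdot_k\mathbf q_{ij}s_{ab}u$; $=0$ otherwise; extended by $\mathbf v\bullet_k(\mathbf q^\alpha u)=\mathbf q^\alpha(\mathbf v\bullet_ku)$, $\bullet_k0=0$, compositions acting rightmost operator first. $\rho(\mathbf v_{a_rb_r}\cdots\mathbf v_{a_1b_1})=\mathbf v_{a_1b_1}\cdots\mathbf v_{a_rb_r}$; for $u\in S_n$, $\rho_n(u)=uw_0$ (i.e. $\rho_n(u)(i)=u(n-i+1)$), where $w_0$ is the longest element of $S_n$; for $\alpha=(\alpha_1,\dots,\alpha_{n-1})$, $\mathfrak h(\alpha)=(\alpha_{n-1},\dots,\alpha_1)$. -}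

module Defs where

open import Data.Nat using (ℕ; zero; suc; _+_; _*_; _<ᵇ_; _≤ᵇ_)
open import Data.Bool using (Bool; true; false; if_then_else_; _∧_)
open import Data.Fin using (Fin; toℕ; _≟_)
import Data.Fin as F
open import Data.Vec using (Vec; lookup; tabulate; map; zipWith; replicate; foldr)
import Data.Vec as V
open import Data.List using (List; []; _∷_)
import Data.List as L
open import Data.Maybe using (Maybe; just; nothing)
open import Data.Product using (Σ; ∃; ∃-syntax; _×_; _,_)
open import Data.Sum using (_⊎_)
open import Relation.Nullary using (¬_; does)
open import Relation.Binary.PropositionalEquality using (_≡_)

-- Conventions: we work with n = suc m.
-- Positions / values 1..n of the paper are encoded 0-based as Fin (suc m):
-- the element p : Fin (suc m) stands for toℕ p + 1.
-- A permutation w ∈ S_n is given in one-line notation as a vector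
-- w : Vec (Fin n) n with w(i) = lookup w i (plus the IsPerm predicate).
-- A monomial q^α (α ∈ ℕ^(n-1)) is its exponent vector α : Vec ℕ m,
-- entry t : Fin m being the exponent of q_(t+1).

Perm : ℕ → Set
Perm n = Vec (Fin n) n

IsPerm : ∀ {n} → Perm n → Set
IsPerm {n} w = ∀ (i j : Fin n) → lookup w i ≡ lookup w j → i ≡ j

swapF : ∀ {n} → Fin n → Fin n → Fin n → Fin n
swapF a b p = if does (p ≟ a) then b else (if does (p ≟ b) then a else p)

-- left multiplication  s_ab u  (exchange the values a and b)
sL : ∀ {n} → Fin n → Fin n → Perm n → Perm n
sL a b u = map (swapF a b) u

-- right multiplication  w s_ij  (exchange the positions i and j)
sR : ∀ {n} → Perm n → Fin n → Fin n → Perm n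
sR w i j = tabulate (λ p → lookup w (swapF i j p))

count : ∀ {n} → (Fin n → Bool) → ℕ
count {n} P = foldr (λ _ → ℕ) (λ b s → (if b then 1 else 0) + s) 0 (tabulate P)

inv : ∀ {n} → Perm n → ℕ
inv {n} w =
  foldr (λ _ → ℕ) _+_ 0
    (tabulate (λ i → count (λ j → (toℕ i <ᵇ toℕ j) ∧ (toℕ (lookup w j) <ᵇ toℕ (lookup w i)))))

deg : ∀ {m} → Vec ℕ m → ℕ
deg = foldr (λ _ → ℕ) _+_ 0

-- elements q^α w of S_n[q]  (n = suc m)
QP : ℕ → Set
QP m = Vec ℕ m × Perm (suc m)

len : ∀ {m} → QP m → ℕ
len (α , w) = inv w + 2 * deg α

𝟘 : ∀ {m} → Vec ℕ m
𝟘 {m} = replicate m 0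

_⊕_ : ∀ {m} → Vec ℕ m → Vec ℕ m → Vec ℕ m
_⊕_ = zipWith _+_

-- exponent vector of q_ij = q_i ⋯ q_(j-1) (positions i<j, 0-based encoded)
qe : ∀ {m} → Fin (suc m) → Fin (suc m) → Vec ℕ m
qe i j = tabulate (λ t → if (toℕ i ≤ᵇ toℕ t) ∧ (toℕ t <ᵇ toℕ j) then 1 else 0)

-- Quantum k-Bruhat covers (extended q-multiplicatively):
--   q^α w ⋖_k q^α w s_ij         if ℓ(q^α w s_ij) = ℓ(q^α w) + 1
--   q^α w ⋖_k q^α q_ij w s_ij    if ℓ(q^α q_ij w s_ij) = ℓ(q^α w) + 1
-- for 1-based positions i ≤ k < j, i.e. 0-based  toℕ i < k ≤ toℕ j.
Cover : ∀ {m} → ℕ → QP m → QP m → Set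
Cover {m} k (α , w) (β , w') =
  ∃[ i ] ∃[ j ] ((toℕ i Data.Nat.< k) × (k Data.Nat.≤ toℕ j) ×
    ( ((β ≡ α) × (w' ≡ sR w i j) × (len (β , w') ≡ suc (len (α , w))))
    ⊎ ((β ≡ α ⊕ qe i j) × (w' ≡ sR w i j) × (len (β , w') ≡ suc (len (α , w))))))

-- The action of a single operator v_ab on q^α u, as a (functional) relation;
-- the result `nothing` stands for 0.
data Step {m : ℕ} (k : ℕ) : Fin (suc m) × Fin (suc m) → QP m → Maybe (QP m) → Set where
  up     : ∀ {a b α u} → a F.< b → Cover k (𝟘 , u) (𝟘 , sL a b u) →
           Step k (a , b) (α , u) (just (α , sL a b u))
  upZero : ∀ {a b α u} → a F.< b → ¬ Cover k (𝟘 , u) (𝟘 , sL a b u) →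
           Step k (a , b) (α , u) nothing
  down   : ∀ {a b α u} (i j : Fin (suc m)) → b F.< a →
           lookup u i ≡ a → lookup u j ≡ b → i F.< j →
           Cover k (𝟘 , u) (qe i j , sL a b u) →
           Step k (a , b) (α , u) (just (α ⊕ qe i j , sL a b u))
  downZero : ∀ {a b α u} → b F.< a →
           ¬ (Σ (Fin (suc m)) λ i → Σ (Fin (suc m)) λ j →
                (lookup u i ≡ a) × (lookup u j ≡ b) × (i F.< j) ×
                Cover k (𝟘 , u) (qe i j , sL a b u)) →
           Step k (a , b) (α , u) nothing

-- Action of a composition v_{a_r b_r} ⋯ v_{a_1 b_1}, given as the list
-- (a_r , b_r) ∷ ⋯ ∷ (a_1 , b_1) ∷ [] ; the rightmost operator acts first.
data Acts {m : ℕ} (k : ℕ) : List (Fin (suc m) × Fin (suc m)) → QP m → Maybe (QP m) → Set where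
  nil   : ∀ {x} → Acts k [] x (just x)
  cons  : ∀ {v vs x y r} → Acts k vs x (just y) → Step k v y r → Acts k (v ∷ vs) x r
  consZ : ∀ {v vs x} → Acts k vs x nothing → Acts k (v ∷ vs) x nothing

ρ : ∀ {A : Set} → List A → List A
ρ = L.reverse

-- ρ_n(u) = u w₀ : ρ_n(u)(i) = u(n - i + 1)
ρₙ : ∀ {n} → Perm n → Perm n
ρₙ = V.reverse

𝔥 : ∀ {m} → Vec ℕ m → Vec ℕ m
𝔥 = V.reverse

-- Right multiplication by the longest element w₀ reverses the quantum Bruhat
-- graph and exchanges k with n − k: ℓ(x w₀) = ℓ(w₀) − ℓ(x),
-- (w s_ij) w₀ = (w w₀) s_{n+1−j,n+1−i}, and 𝔥 sends q_ij to q_{n+1−j,n+1−i},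
-- so a cover u ⋖_k q^β w turns into w w₀ ⋖_{n−k} q^{𝔥 β} u w₀.  The operators
-- v_ab act by left multiplication, which commutes with right multiplication by
-- w₀; hence every step of a chain u → ⋯ → q^α w, read backwards, is a step of
-- the reversed word.  As ρ, ρₙ, 𝔥 and k ↦ n − k are involutions, the converse
-- is the same statement applied to the reversed chain.

module Submission where

open import Defs
open import Data.Bool using (Bool; true; false; not; _∧_; T; if_then_else_)
import Data.Bool.Properties as Bool
open import Data.Fin using (Fin; toℕ; opposite; fromℕ; inject₁)
import Data.Fin as Fin
import Data.Fin.Permutation as Permutation
open import Data.Fin.Properties using (toℕ<n; toℕ-injective; opposite-prop; opposite-involutive)
open import Data.List using (List; _∷_)
import Data.List as L
import Data.List.Properties as L
open import Data.List.Relation.Unary.All using (All)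
open import Data.Maybe using (just)
open import Data.Nat using (ℕ; suc; _+_; _*_; _∸_; _≤_; _<_; _<ᵇ_; _≤ᵇ_; s≤s)
import Data.Nat.Properties as ℕ
open import Algebra.Properties.CommutativeMonoid.Sum ℕ.+-0-commutativeMonoid
  using (sum-syntax; ∑-permute; ∑-comm; ∑-distrib-+; sum-cong-≗)
open import Data.Product using (Σ-syntax; _×_; _,_; proj₁; proj₂)
import Data.Sum as Sum
open import Data.Vec using (Vec; []; _∷_; lookup; replicate; zipWith)
import Data.Vec as V
import Data.Vec.Properties as Vec
open import Data.Vec.Relation.Binary.Pointwise.Extensional using (ext; Pointwise-≡⇒≡)
open import Function using (_∘_)
open import Function.Bundles using (_⇔_; mk⇔)
open import Relation.Nullary using (yes; no; contradiction)
open import Relation.Nullary.Reflects using (det; fromEquivalence)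
open import Relation.Binary.PropositionalEquality

involutive⇒injective : ∀ {A : Set} {f : A → A} → (∀ x → f (f x) ≡ x) →
                       ∀ {x y} → f x ≡ f y → x ≡ y
involutive⇒injective {f = f} f∘f≡id {x} {y} fx≡fy =
  trans (sym (f∘f≡id x)) (trans (cong f fx≡fy) (f∘f≡id y))

opposite-injective : ∀ {n} {i j : Fin n} → opposite i ≡ opposite j → i ≡ j
opposite-injective = involutive⇒injective opposite-involutive

lookup-∷ʳ-fromℕ : ∀ {A : Set} {n} (xs : Vec A n) x → lookup (xs V.∷ʳ x) (fromℕ n) ≡ x
lookup-∷ʳ-fromℕ []       x = refl
lookup-∷ʳ-fromℕ (_ ∷ xs) x = lookup-∷ʳ-fromℕ xs x

lookup-∷ʳ-inject₁ : ∀ {A : Set} {n} (xs : Vec A n) x i →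
                    lookup (xs V.∷ʳ x) (inject₁ i) ≡ lookup xs i
lookup-∷ʳ-inject₁ (_ ∷ xs) x Fin.zero    = refl
lookup-∷ʳ-inject₁ (_ ∷ xs) x (Fin.suc i) = lookup-∷ʳ-inject₁ xs x i

lookup-reverse-opposite : ∀ {A : Set} {n} (xs : Vec A n) i →
                          lookup (V.reverse xs) (opposite i) ≡ lookup xs i
lookup-reverse-opposite (x ∷ xs) i
  rewrite Vec.reverse-∷ x xs with i
... | Fin.zero  = lookup-∷ʳ-fromℕ (V.reverse xs) x
... | Fin.suc i = trans (lookup-∷ʳ-inject₁ (V.reverse xs) x (opposite i))
                        (lookup-reverse-opposite xs i)

lookup-reverse : ∀ {A : Set} {n} (xs : Vec A n) i →
                 lookup (V.reverse xs) i ≡ lookup xs (opposite i)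
lookup-reverse xs i =
  trans (cong (lookup (V.reverse xs)) (sym (opposite-involutive i)))
        (lookup-reverse-opposite xs (opposite i))

reverse-zipWith : ∀ {A B C : Set} {n} (f : A → B → C) (xs : Vec A n) ys →
                  V.reverse (zipWith f xs ys) ≡ zipWith f (V.reverse xs) (V.reverse ys)
reverse-zipWith f xs ys = Pointwise-≡⇒≡ (ext λ i → begin
  lookup (V.reverse (zipWith f xs ys)) i
    ≡⟨ lookup-reverse (zipWith f xs ys) i ⟩
  lookup (zipWith f xs ys) (opposite i)
    ≡⟨ Vec.lookup-zipWith f (opposite i) xs ys ⟩
  f (lookup xs (opposite i)) (lookup ys (opposite i))
    ≡⟨ cong₂ f (lookup-reverse xs i) (lookup-reverse ys i) ⟨
  f (lookup (V.reverse xs) i) (lookup (V.reverse ys) i)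
    ≡⟨ Vec.lookup-zipWith f i (V.reverse xs) (V.reverse ys) ⟨
  lookup (zipWith f (V.reverse xs) (V.reverse ys)) i ∎)
  where open ≡-Reasoning

reverse-replicate : ∀ {A : Set} n (x : A) → V.reverse (replicate n x) ≡ replicate n x
reverse-replicate n x = Pointwise-≡⇒≡ (ext λ i →
  trans (lookup-reverse (replicate n x) i)
        (trans (Vec.lookup-replicate (opposite i) x) (sym (Vec.lookup-replicate i x))))

-- Also serves for _<ᵇ_, as suc a ≤ᵇ b computes to a <ᵇ b.
∸-≤ᵇ-reverse : ∀ {M x y} → y ≤ M → (M ∸ x ≤ᵇ M ∸ y) ≡ (y ≤ᵇ x)
∸-≤ᵇ-reverse {M} {x} {y} y≤M = det (ℕ.≤ᵇ-reflects-≤ (M ∸ x) (M ∸ y))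
  (fromEquivalence (ℕ.∸-monoʳ-≤ M ∘ ℕ.≤ᵇ⇒≤ y x) (ℕ.≤⇒≤ᵇ ∘ ℕ.∸-cancelʳ-≤ y≤M))

<ᵇ-≢ : ∀ {x y} → x ≢ y → (x <ᵇ y) ≡ not (y <ᵇ x)
<ᵇ-≢ {x} {y} x≢y with x <ᵇ y in x<ᵇy | y <ᵇ x in y<ᵇx
... | true  | false = refl
... | false | true  = refl
... | true  | true  = contradiction (from-T {y} {x} y<ᵇx) (ℕ.<⇒≯ (from-T {x} {y} x<ᵇy))
  where
  from-T : ∀ {a b} → (a <ᵇ b) ≡ true → a < b
  from-T {a} {b} e = ℕ.<ᵇ⇒< a b (subst T (sym e) _)
... | false | false = contradiction (ℕ.≤-antisym (≮ x<ᵇy) (≮ y<ᵇx)) (x≢y ∘ sym)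
  where
  ≮ : ∀ {a b} → (a <ᵇ b) ≡ false → b ≤ a
  ≮ e = ℕ.≮⇒≥ (λ a<b → subst T e (ℕ.<⇒<ᵇ a<b))

opposite-<ᵇ : ∀ {n} (i j : Fin n) → (toℕ (opposite i) <ᵇ toℕ (opposite j)) ≡ (toℕ j <ᵇ toℕ i)
opposite-<ᵇ {n} i j rewrite opposite-prop i | opposite-prop j =
  trans (cong (_≤ᵇ n ∸ suc (toℕ j)) (sym (ℕ.+-∸-assoc 1 (toℕ<n i))))
        (∸-≤ᵇ-reverse {x = toℕ i} (toℕ<n j))

opposite-<-∸ : ∀ {n k} (j : Fin n) → k ≤ toℕ j → toℕ (opposite j) < n ∸ k
opposite-<-∸ {n} {k} j k≤j = subst (_< n ∸ k) (sym (opposite-prop j))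
  (ℕ.∸-monoʳ-< (s≤s k≤j) (toℕ<n j))

∸-≤-opposite : ∀ {n k} (i : Fin n) → toℕ i < k → n ∸ k ≤ toℕ (opposite i)
∸-≤-opposite {n} {k} i i<k = subst (n ∸ k ≤_) (sym (opposite-prop i)) (ℕ.∸-monoʳ-≤ n i<k)

opposite-< : ∀ {n} {i j : Fin n} → i Fin.< j → opposite j Fin.< opposite i
opposite-< {i = i} {j} i<j =
  subst (toℕ (opposite j) <_) (sym (opposite-prop i)) (opposite-<-∸ j i<j)

swapF-cases : ∀ {n} (a b p : Fin n) (P : Fin n → Set) →
  (p ≡ a → P b) → (p ≢ a → p ≡ b → P a) → (p ≢ a → p ≢ b → P p) → P (swapF a b p)
swapF-cases a b p P p≡a p≡b otherwise with p Fin.≟ a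
... | yes e = p≡a e
... | no p≢a with p Fin.≟ b
...   | yes e = p≡b p≢a e
...   | no p≢b = otherwise p≢a p≢b

swapF-left : ∀ {n} (a b : Fin n) → swapF a b a ≡ b
swapF-left a b = swapF-cases a b a (_≡ b) (λ _ → refl)
  (λ a≢a _ → contradiction refl a≢a) (λ a≢a _ → contradiction refl a≢a)

swapF-right : ∀ {n} (a b : Fin n) → swapF a b b ≡ a
swapF-right a b = swapF-cases a b b (_≡ a) (λ b≡a → b≡a) (λ _ _ → refl)
  (λ _ b≢b → contradiction refl b≢b)

swapF-involutive : ∀ {n} (a b p : Fin n) → swapF a b (swapF a b p) ≡ p
swapF-involutive a b p = swapF-cases a b p (λ x → swapF a b x ≡ p)
  (λ p≡a → trans (swapF-right a b) (sym p≡a))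
  (λ _ p≡b → trans (swapF-left a b) (sym p≡b))
  (λ p≢a p≢b → swapF-cases a b p (_≡ p)
     (λ p≡a → contradiction p≡a p≢a) (λ _ p≡b → contradiction p≡b p≢b) (λ _ _ → refl))

swapF-comm : ∀ {n} (a b p : Fin n) → swapF a b p ≡ swapF b a p
swapF-comm a b p = swapF-cases a b p (λ x → x ≡ swapF b a p)
  (λ { refl → sym (swapF-right b p) })
  (λ _ → λ { refl → sym (swapF-left p a) })
  (λ p≢a p≢b → sym (swapF-cases b a p (_≡ p)
     (λ p≡b → contradiction p≡b p≢b) (λ _ p≡a → contradiction p≡a p≢a) (λ _ _ → refl)))

swapF-conjugate : ∀ {n k} (f : Fin n → Fin k) → (∀ {x y} → f x ≡ f y → x ≡ y) →
  (a b p : Fin n) → f (swapF a b p) ≡ swapF (f a) (f b) (f p)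
swapF-conjugate f f-inj a b p = swapF-cases a b p (λ x → f x ≡ swapF (f a) (f b) (f p))
  (λ { refl → sym (swapF-left (f p) (f b)) })
  (λ _ → λ { refl → sym (swapF-right (f a) (f p)) })
  (λ p≢a p≢b → sym (swapF-cases (f a) (f b) (f p) (_≡ f p)
     (λ e → contradiction (f-inj e) p≢a) (λ _ e → contradiction (f-inj e) p≢b) (λ _ _ → refl)))

sR-involutive : ∀ {n} (w : Perm n) i j → sR (sR w i j) i j ≡ w
sR-involutive w i j = Pointwise-≡⇒≡ (ext λ p →
  trans (Vec.lookup∘tabulate _ p)
        (trans (Vec.lookup∘tabulate _ (swapF i j p)) (cong (lookup w) (swapF-involutive i j p))))

ρₙ-sR : ∀ {n} (w : Perm n) i j → ρₙ (sR w i j) ≡ sR (ρₙ w) (opposite j) (opposite i)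
ρₙ-sR w i j = Pointwise-≡⇒≡ (ext λ p → begin
  lookup (ρₙ (sR w i j)) p                      ≡⟨ lookup-reverse (sR w i j) p ⟩
  lookup (sR w i j) (opposite p)                ≡⟨ Vec.lookup∘tabulate _ (opposite p) ⟩
  lookup w (swapF i j (opposite p))             ≡⟨ cong (lookup w) (swap-opposite p) ⟩
  lookup w (opposite (swapF (opposite j) (opposite i) p))
    ≡⟨ lookup-reverse w (swapF (opposite j) (opposite i) p) ⟨
  lookup (ρₙ w) (swapF (opposite j) (opposite i) p)
    ≡⟨ Vec.lookup∘tabulate _ p ⟨
  lookup (sR (ρₙ w) (opposite j) (opposite i)) p ∎)
  where
  open ≡-Reasoning
  swap-opposite : ∀ p → swapF i j (opposite p) ≡ opposite (swapF (opposite j) (opposite i) p)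
  swap-opposite p = begin
    swapF i j (opposite p)    ≡⟨ swapF-comm i j (opposite p) ⟩
    swapF j i (opposite p)    ≡⟨ cong₂ (λ x y → swapF x y (opposite p))
                                       (opposite-involutive j) (opposite-involutive i) ⟨
    swapF (opposite (opposite j)) (opposite (opposite i)) (opposite p)
      ≡⟨ swapF-conjugate opposite opposite-injective (opposite j) (opposite i) p ⟨
    opposite (swapF (opposite j) (opposite i) p) ∎

ρₙ-sL : ∀ {n} (a b : Fin n) (w : Perm n) → ρₙ (sL a b w) ≡ sL a b (ρₙ w)
ρₙ-sL a b w = sym (Vec.map-reverse (swapF a b) w)

sL-involutive : ∀ {n} (a b : Fin n) (w : Perm n) → sL a b (sL a b w) ≡ w
sL-involutive a b w =
  trans (sym (Vec.map-∘ (swapF a b) (swapF a b) w))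
        (trans (Vec.map-cong (swapF-involutive a b) w) (Vec.map-id w))

sL-ρₙ-sL : ∀ {n} (a b : Fin n) (w : Perm n) → sL a b (ρₙ (sL a b w)) ≡ ρₙ w
sL-ρₙ-sL a b w = trans (sym (ρₙ-sL a b (sL a b w))) (cong ρₙ (sL-involutive a b w))

IsPerm-ρₙ : ∀ {n} (w : Perm n) → IsPerm w → IsPerm (ρₙ w)
IsPerm-ρₙ w w-inj i j e = opposite-injective
  (w-inj _ _ (trans (sym (lookup-reverse w i)) (trans e (lookup-reverse w j))))

IsPerm-sL : ∀ {n} (a b : Fin n) (w : Perm n) → IsPerm w → IsPerm (sL a b w)
IsPerm-sL a b w w-inj i j e = w-inj i j (involutive⇒injective {f = swapF a b} (swapF-involutive a b)
  (trans (sym (Vec.lookup-map i (swapF a b) w)) (trans e (Vec.lookup-map j (swapF a b) w))))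

-- Inversions: ℓ(w w₀) + ℓ(w) = ℓ(w₀)

χ : Bool → ℕ
χ b = if b then 1 else 0

∑-reverse : ∀ {n} (f : Fin n → ℕ) → ∑[ i < n ] f i ≡ ∑[ i < n ] f (opposite i)
∑-reverse f = ∑-permute f Permutation.reverse

sum≡∑-lookup : ∀ {n} (xs : Vec ℕ n) → V.sum xs ≡ ∑[ i < n ] lookup xs i
sum≡∑-lookup []       = refl
sum≡∑-lookup (x ∷ xs) = cong (x +_) (sum≡∑-lookup xs)

count≡∑ : ∀ {n} (P : Fin n → Bool) → count P ≡ ∑[ i < n ] χ (P i)
count≡∑ {0}     P = refl
count≡∑ {suc n} P = cong (χ (P Fin.zero) +_) (count≡∑ (P ∘ Fin.suc))

inverted ascending : ∀ {n} → Perm n → Fin n → Fin n → Bool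
inverted  w i j = (toℕ i <ᵇ toℕ j) ∧ (toℕ (lookup w j) <ᵇ toℕ (lookup w i))
ascending w i j = (toℕ i <ᵇ toℕ j) ∧ (toℕ (lookup w i) <ᵇ toℕ (lookup w j))

pairs : ℕ → ℕ
pairs n = ∑[ i < n ] ∑[ j < n ] χ (toℕ i <ᵇ toℕ j)

inv≡∑ : ∀ {n} (w : Perm n) → inv w ≡ ∑[ i < n ] ∑[ j < n ] χ (inverted w i j)
inv≡∑ w = trans (sum≡∑-lookup (V.tabulate (count ∘ inverted w)))
  (sum-cong-≗ λ i → trans (Vec.lookup∘tabulate (count ∘ inverted w) i) (count≡∑ (inverted w i)))

inverted-reverse : ∀ {n} (w : Perm n) i j →
                   inverted (ρₙ w) (opposite i) (opposite j) ≡ ascending w j i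
inverted-reverse w i j = cong₂ _∧_ (opposite-<ᵇ i j)
  (cong₂ (λ x y → toℕ x <ᵇ toℕ y) (lookup-reverse-opposite w j) (lookup-reverse-opposite w i))

χ-∧-split : ∀ b {p q} → (T b → p ≡ not q) → χ (b ∧ p) + χ (b ∧ q) ≡ χ b
χ-∧-split false             _    = refl
χ-∧-split true {q = false} p≡¬q rewrite p≡¬q _ = refl
χ-∧-split true {q = true}  p≡¬q rewrite p≡¬q _ = refl

ascending+inverted : ∀ {n} (w : Perm n) → IsPerm w → ∀ i j →
  χ (ascending w i j) + χ (inverted w i j) ≡ χ (toℕ i <ᵇ toℕ j)
ascending+inverted w w-inj i j = χ-∧-split (toℕ i <ᵇ toℕ j) λ i<ᵇj → <ᵇ-≢ λ wi≡wj →
  ℕ.<-irrefl (cong toℕ (w-inj i j (toℕ-injective wi≡wj))) (ℕ.<ᵇ⇒< _ _ i<ᵇj)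

inv-reverse+inv : ∀ {n} (w : Perm n) → IsPerm w → inv (ρₙ w) + inv w ≡ pairs n
inv-reverse+inv {n} w w-inj = begin
  inv (ρₙ w) + inv w
    ≡⟨ cong₂ _+_ (inv≡∑ (ρₙ w)) (inv≡∑ w) ⟩
  ∑[ i < n ] ∑[ j < n ] χ (inverted (ρₙ w) i j) + Inverted
    ≡⟨ cong (_+ Inverted)
         (trans (∑-reverse (λ i → ∑[ j < n ] χ (inverted (ρₙ w) i j)))
                (sum-cong-≗ λ i → ∑-reverse (χ ∘ inverted (ρₙ w) (opposite i)))) ⟩
  ∑[ i < n ] ∑[ j < n ] χ (inverted (ρₙ w) (opposite i) (opposite j)) + Inverted
    ≡⟨ cong (_+ Inverted) (sum-cong-≗ λ i → sum-cong-≗ λ j → cong χ (inverted-reverse w i j)) ⟩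
  ∑[ i < n ] ∑[ j < n ] χ (ascending w j i) + Inverted
    ≡⟨ cong (_+ Inverted) (∑-comm (λ i j → χ (ascending w j i))) ⟩
  ∑[ j < n ] ∑[ i < n ] χ (ascending w j i) + Inverted
    ≡⟨ ∑-distrib-+ (λ i → ∑[ j < n ] χ (ascending w i j)) (λ i → ∑[ j < n ] χ (inverted w i j)) ⟨
  ∑[ i < n ] (∑[ j < n ] χ (ascending w i j) + ∑[ j < n ] χ (inverted w i j))
    ≡⟨ sum-cong-≗ (λ i → ∑-distrib-+ (χ ∘ ascending w i) (χ ∘ inverted w i)) ⟨
  ∑[ i < n ] ∑[ j < n ] (χ (ascending w i j) + χ (inverted w i j))
    ≡⟨ sum-cong-≗ (λ i → sum-cong-≗ (ascending+inverted w w-inj i)) ⟩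
  pairs n ∎
  where
  open ≡-Reasoning
  Inverted : ℕ
  Inverted = ∑[ i < n ] ∑[ j < n ] χ (inverted w i j)

module _ {m : ℕ} where

  ⊕-identityˡ : (α : Vec ℕ m) → 𝟘 ⊕ α ≡ α
  ⊕-identityˡ = Vec.zipWith-identityˡ ℕ.+-identityˡ

  ⊕-identityʳ : (α : Vec ℕ m) → α ⊕ 𝟘 ≡ α
  ⊕-identityʳ = Vec.zipWith-identityʳ ℕ.+-identityʳ

  ⊕-assoc : (α β γ : Vec ℕ m) → (α ⊕ β) ⊕ γ ≡ α ⊕ (β ⊕ γ)
  ⊕-assoc = Vec.zipWith-assoc ℕ.+-assoc

  ⊕-comm : (α β : Vec ℕ m) → α ⊕ β ≡ β ⊕ α
  ⊕-comm = Vec.zipWith-comm ℕ.+-comm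

  𝔥-⊕ : (α β : Vec ℕ m) → 𝔥 (α ⊕ β) ≡ 𝔥 α ⊕ 𝔥 β
  𝔥-⊕ = reverse-zipWith _+_

  𝔥-𝟘 : 𝔥 (𝟘 {m}) ≡ 𝟘
  𝔥-𝟘 = reverse-replicate m 0

  ⊕-𝔥-𝟘 : (α : Vec ℕ m) → α ⊕ 𝔥 𝟘 ≡ α
  ⊕-𝔥-𝟘 α = trans (cong (α ⊕_) 𝔥-𝟘) (⊕-identityʳ α)

  deg-𝔥 : (α : Vec ℕ m) → deg (𝔥 α) ≡ deg α
  deg-𝔥 α = begin
    deg (𝔥 α)                          ≡⟨ sum≡∑-lookup (𝔥 α) ⟩
    ∑[ t < m ] lookup (𝔥 α) t          ≡⟨ sum-cong-≗ (lookup-reverse α) ⟩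
    ∑[ t < m ] lookup α (opposite t)   ≡⟨ ∑-reverse (lookup α) ⟨
    ∑[ t < m ] lookup α t              ≡⟨ sum≡∑-lookup α ⟨
    deg α                              ∎
    where open ≡-Reasoning

  qe-reverse : (i j : Fin (suc m)) → 𝔥 (qe i j) ≡ qe (opposite j) (opposite i)
  qe-reverse i j = Pointwise-≡⇒≡ (ext λ t → begin
    lookup (𝔥 (qe i j)) t
      ≡⟨ lookup-reverse (qe i j) t ⟩
    lookup (qe i j) (opposite t)
      ≡⟨ Vec.lookup∘tabulate _ (opposite t) ⟩
    χ ((toℕ i ≤ᵇ toℕ (opposite t)) ∧ (toℕ (opposite t) <ᵇ toℕ j))
      ≡⟨ cong (λ s → χ ((toℕ i ≤ᵇ s) ∧ (s <ᵇ toℕ j))) (opposite-prop t) ⟩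
    χ ((toℕ i ≤ᵇ m ∸ suc (toℕ t)) ∧ (m ∸ suc (toℕ t) <ᵇ toℕ j))
      ≡⟨ cong₂ (λ x y → χ (x ∧ y)) (lower t) (upper t) ⟩
    χ ((toℕ t <ᵇ m ∸ toℕ i) ∧ (m ∸ toℕ j ≤ᵇ toℕ t))
      ≡⟨ cong χ (Bool.∧-comm (toℕ t <ᵇ m ∸ toℕ i) (m ∸ toℕ j ≤ᵇ toℕ t)) ⟩
    χ ((m ∸ toℕ j ≤ᵇ toℕ t) ∧ (toℕ t <ᵇ m ∸ toℕ i))
      ≡⟨ cong₂ (λ x y → χ ((x ≤ᵇ toℕ t) ∧ (toℕ t <ᵇ y))) (opposite-prop j) (opposite-prop i) ⟨
    χ ((toℕ (opposite j) ≤ᵇ toℕ t) ∧ (toℕ t <ᵇ toℕ (opposite i)))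
      ≡⟨ Vec.lookup∘tabulate _ t ⟨
    lookup (qe (opposite j) (opposite i)) t ∎)
    where
    open ≡-Reasoning
    -- both sides say i + t + 1 ≤ m, respectively m ≤ t + j
    lower : (t : Fin m) → (toℕ i ≤ᵇ m ∸ suc (toℕ t)) ≡ (toℕ t <ᵇ m ∸ toℕ i)
    lower t = trans (cong (_≤ᵇ m ∸ suc (toℕ t)) (sym (ℕ.m∸[m∸n]≡n (ℕ.≤-pred (toℕ<n i)))))
                    (∸-≤ᵇ-reverse {x = m ∸ toℕ i} (toℕ<n t))
    upper : (t : Fin m) → (m ∸ suc (toℕ t) <ᵇ toℕ j) ≡ (m ∸ toℕ j ≤ᵇ toℕ t)
    upper t = trans (cong₂ _≤ᵇ_ (sym (ℕ.+-∸-assoc 1 (toℕ<n t)))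
                                (sym (ℕ.m∸[m∸n]≡n (ℕ.≤-pred (toℕ<n j)))))
                    (∸-≤ᵇ-reverse {x = toℕ t} (ℕ.m∸n≤m m (toℕ j)))

deg-𝟘 : ∀ {m} → deg (𝟘 {m}) ≡ 0
deg-𝟘 {0}     = refl
deg-𝟘 {suc m} = deg-𝟘 {m}

-- Reversing quantum Bruhat covers

len-𝟘 : ∀ {m} (w : Perm (suc m)) → len (𝟘 {m} , w) ≡ inv w
len-𝟘 {m} w = trans (cong (λ d → inv w + 2 * d) (deg-𝟘 {m})) (ℕ.+-identityʳ (inv w))

len-reverse : ∀ {m} (β : Vec ℕ m) {y z : Perm (suc m)} → IsPerm y → IsPerm z →
  len (β , z) ≡ suc (len (𝟘 , y)) → len (𝔥 β , ρₙ y) ≡ suc (len (𝟘 , ρₙ z))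
len-reverse {m} β {y} {z} y-inj z-inj ℓz≡1+ℓy = begin
  len (𝔥 β , ρₙ y)          ≡⟨ cong (λ d → inv (ρₙ y) + 2 * d) (deg-𝔥 β) ⟩
  inv (ρₙ y) + 2 * deg β
    ≡⟨ exchange {inv (ρₙ y)} {inv y} {inv (ρₙ z)} {inv z}
         (trans (inv-reverse+inv y y-inj) (sym (inv-reverse+inv z z-inj)))
         (trans ℓz≡1+ℓy (cong suc (len-𝟘 y))) ⟩
  suc (inv (ρₙ z))          ≡⟨ cong suc (len-𝟘 (ρₙ z)) ⟨
  suc (len (𝟘 , ρₙ z))      ∎
  where
  open ≡-Reasoning
  exchange : ∀ {A a C c d} → A + a ≡ C + c → c + d ≡ suc a → A + d ≡ suc C
  exchange {A} {a} {C} {c} {d} A+a≡C+c c+d≡1+a = ℕ.+-cancelʳ-≡ c (A + d) (suc C) (begin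
    A + d + c     ≡⟨ ℕ.+-assoc A d c ⟩
    A + (d + c)   ≡⟨ cong (A +_) (trans (ℕ.+-comm d c) c+d≡1+a) ⟩
    A + suc a     ≡⟨ ℕ.+-suc A a ⟩
    suc (A + a)   ≡⟨ cong suc A+a≡C+c ⟩
    suc (C + c)   ∎)

cover-reverse : ∀ {m k} {β : Vec ℕ m} {y z : Perm (suc m)} → IsPerm y → IsPerm z →
  Cover k (𝟘 , y) (β , z) → Cover (suc m ∸ k) (𝟘 , ρₙ z) (𝔥 β , ρₙ y)
cover-reverse {m} {k} {β} {y} {z} y-inj z-inj (i , j , i<k , k≤j , edge) =
  opposite j , opposite i , opposite-<-∸ j k≤j , ∸-≤-opposite i i<k ,
  Sum.map (reverse-edge λ β≡𝟘 → trans (cong 𝔥 β≡𝟘) 𝔥-𝟘)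
          (reverse-edge λ β≡q → trans (cong 𝔥 β≡q) 𝔥-𝟘⊕qe)
          edge
  where
  𝔥-𝟘⊕qe : 𝔥 (𝟘 ⊕ qe i j) ≡ 𝟘 ⊕ qe (opposite j) (opposite i)
  𝔥-𝟘⊕qe = trans (𝔥-⊕ 𝟘 (qe i j)) (cong₂ _⊕_ 𝔥-𝟘 (qe-reverse i j))
  reverse-edge : ∀ {γ γ′} → (β ≡ γ → 𝔥 β ≡ γ′) →
    (β ≡ γ) × (z ≡ sR y i j) × (len (β , z) ≡ suc (len (𝟘 , y))) →
    (𝔥 β ≡ γ′) × (ρₙ y ≡ sR (ρₙ z) (opposite j) (opposite i)) ×
    (len (𝔥 β , ρₙ y) ≡ suc (len (𝟘 , ρₙ z)))
  reverse-edge 𝔥β≡ (β≡ , z≡ , ℓz) =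
    𝔥β≡ β≡ ,
    trans (cong ρₙ (trans (sym (sR-involutive y i j)) (cong (λ x → sR x i j) (sym z≡))))
          (ρₙ-sR z i j) ,
    len-reverse β {y} {z} y-inj z-inj ℓz

cover-reverse-sL : ∀ {m k} {β : Vec ℕ m} (a b : Fin (suc m)) (y : Perm (suc m)) → IsPerm y →
  Cover k (𝟘 , y) (β , sL a b y) →
  Cover (suc m ∸ k) (𝟘 , ρₙ (sL a b y)) (𝔥 β , sL a b (ρₙ (sL a b y)))
cover-reverse-sL {β = β} a b y y-inj c =
  subst (λ x → Cover _ (𝟘 , ρₙ (sL a b y)) (𝔥 β , x)) (sym (sL-ρₙ-sL a b y))
    (cover-reverse {y = y} {z = sL a b y} y-inj (IsPerm-sL a b y y-inj) c)

-- Reversing chains of operators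

step-perm : ∀ {m k v α γ y z} → Step {m} k v (α , y) (just (γ , z)) → IsPerm y → IsPerm z
step-perm (up {a} {b} {u = y} _ _)           = IsPerm-sL a b y
step-perm (down {a} {b} {u = y} _ _ _ _ _ _ _) = IsPerm-sL a b y

acts-perm : ∀ {m k vs α γ u w} → Acts {m} k vs (α , u) (just (γ , w)) → IsPerm u → IsPerm w
acts-perm nil          = λ u-inj → u-inj
acts-perm (cons acts s) = step-perm s ∘ acts-perm acts

acts-∷ʳ : ∀ {m k v ws x y r} → Step {m} k v x (just y) → Acts k ws y r → Acts k (ws L.∷ʳ v) x r
acts-∷ʳ s nil           = cons nil s
acts-∷ʳ s (cons acts t) = cons (acts-∷ʳ s acts) t
acts-∷ʳ s (consZ acts)  = consZ (acts-∷ʳ s acts)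

module _ {m k : ℕ} where

  private
    k′ : ℕ
    k′ = suc m ∸ k

  step-reverse : ∀ {v γ δ y z} → IsPerm y → Step {m} k v (γ , y) (just (δ , z)) →
    Σ[ ε ∈ Vec ℕ m ] (δ ≡ γ ⊕ ε) × (∀ β → Step k′ v (β , ρₙ z) (just (β ⊕ 𝔥 ε , ρₙ y)))
  step-reverse {γ = γ} {y = y} y-inj (up {a} {b} a<b c) =
    𝟘 , sym (⊕-identityʳ γ) , λ β →
      subst₂ (λ ε x → Step k′ (a , b) (β , Y) (just (ε , x)))
        (sym (⊕-𝔥-𝟘 β)) (sL-ρₙ-sL a b y)
        (up a<b (subst (λ ε → Cover k′ (𝟘 , Y) (ε , sL a b Y)) 𝔥-𝟘 (cover-reverse-sL a b y y-inj c)))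
    where
    Y : Perm (suc m)
    Y = ρₙ (sL a b y)
  step-reverse {y = y} y-inj (down {a} {b} i j b<a yi≡a yj≡b i<j c) =
    qe i j , refl , λ β →
      subst₂ (λ ε x → Step k′ (a , b) (β , Y) (just (β ⊕ ε , x)))
        (sym (qe-reverse i j)) (sL-ρₙ-sL a b y)
        (down (opposite j) (opposite i) b<a
          (trans (value-at j) (trans (cong (swapF a b) yj≡b) (swapF-right a b)))
          (trans (value-at i) (trans (cong (swapF a b) yi≡a) (swapF-left a b)))
          (opposite-< i<j)
          (subst (λ ε → Cover k′ (𝟘 , Y) (ε , sL a b Y)) (qe-reverse i j) (cover-reverse-sL a b y y-inj c)))
    where
    Y : Perm (suc m)
    Y = ρₙ (sL a b y)
    value-at : ∀ p → lookup Y (opposite p) ≡ swapF a b (lookup y p)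
    value-at p = trans (lookup-reverse-opposite (sL a b y) p) (Vec.lookup-map p (swapF a b) y)

  -- Any starting monomial β, so that the induction never subtracts exponents.
  acts-reverse-⊕ : ∀ {vs δ u w} → IsPerm u → Acts {m} k vs (𝟘 , u) (just (δ , w)) →
    ∀ β → Acts k′ (ρ vs) (β , ρₙ w) (just (β ⊕ 𝔥 δ , ρₙ u))
  acts-reverse-⊕ {u = u} u-inj nil β =
    subst (λ ε → Acts k′ _ (β , ρₙ u) (just (ε , ρₙ u))) (sym (⊕-𝔥-𝟘 β)) nil
  acts-reverse-⊕ {v ∷ vs} {δ} u-inj (cons {y = γ , y} acts s) β
    with step-reverse (acts-perm acts u-inj) s
  ... | ε , δ≡γ⊕ε , s′ =
    subst₂ (λ ws ε′ → Acts k′ ws (β , _) (just (ε′ , _)))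
      (sym (L.unfold-reverse v vs)) exponent
      (acts-∷ʳ (s′ β) (acts-reverse-⊕ u-inj acts (β ⊕ 𝔥 ε)))
    where
    open ≡-Reasoning
    exponent : (β ⊕ 𝔥 ε) ⊕ 𝔥 γ ≡ β ⊕ 𝔥 δ
    exponent = begin
      (β ⊕ 𝔥 ε) ⊕ 𝔥 γ   ≡⟨ ⊕-assoc β (𝔥 ε) (𝔥 γ) ⟩
      β ⊕ (𝔥 ε ⊕ 𝔥 γ)   ≡⟨ cong (β ⊕_) (⊕-comm (𝔥 ε) (𝔥 γ)) ⟩
      β ⊕ (𝔥 γ ⊕ 𝔥 ε)   ≡⟨ cong (β ⊕_) (𝔥-⊕ γ ε) ⟨
      β ⊕ 𝔥 (γ ⊕ ε)     ≡⟨ cong (λ x → β ⊕ 𝔥 x) δ≡γ⊕ε ⟨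
      β ⊕ 𝔥 δ           ∎

  acts-reverse : ∀ {vs δ u w} → IsPerm u → Acts {m} k vs (𝟘 , u) (just (δ , w)) →
    Acts k′ (ρ vs) (𝟘 , ρₙ w) (just (𝔥 δ , ρₙ u))
  acts-reverse {δ = δ} u-inj acts =
    subst (λ ε → Acts k′ _ (𝟘 , _) (just (ε , _))) (⊕-identityˡ (𝔥 δ)) (acts-reverse-⊕ u-inj acts 𝟘)

proposition5p30 : (m : ℕ) → (v : List (Fin (suc m) × Fin (suc m))) →
    All (λ p → proj₁ p ≢ proj₂ p) v →
    (u w : Perm (suc m)) → IsPerm u → IsPerm w →
    (k : ℕ) → 1 ≤ k → k ≤ m → (α : Vec ℕ m) →
    Acts k v (𝟘 , u) (just (α , w)) ⇔
    Acts (suc m ∸ k) (ρ v) (𝟘 , ρₙ w) (just (𝔥 α , ρₙ u))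
proposition5p30 m v _ u w u-inj w-inj k _ k≤m α = mk⇔ (acts-reverse u-inj) backward
  where
  backward : Acts (suc m ∸ k) (ρ v) (𝟘 , ρₙ w) (just (𝔥 α , ρₙ u)) → Acts k v (𝟘 , u) (just (α , w))
  backward acts with acts-reverse (IsPerm-ρₙ w w-inj) acts
  ... | acts′ rewrite ℕ.m∸[m∸n]≡n (ℕ.m≤n⇒m≤1+n k≤m) | L.reverse-involutive v
                    | Vec.reverse-involutive u | Vec.reverse-involutive w
                    | Vec.reverse-involutive α = acts′
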